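{- Let $q$ be a prime power, $r\ge 2$, and let $B$ be a basis of the affine geometry $AG(r-1,q)$, viewed as a matroid of rank $r$. Then there are precisely $(q-1)^{r-1}-1$ hyperplanes $H$ of $AG(r-1,q)$ which contain no element of $B$.
   Context: $AG(r-1,q)$ is the matroid of rank $r$ obtained from the projective geometry $PG(r-1,q)$ (points = $1$-dimensional subspaces of $GF(q)^r$, flats = sets of points in subspaces, rank = dimension of the subspace) by deleting all points of one hyperplane; equivalently its ground set is the $q^{r-1}$ points of the $(r-1)$-dimensional affine space over $GF(q)$ and its flats are the affine subspaces, an affine subspace of dimension $d$ having rank $d+1$. A hyperplane is a flat of rank $r-1$. -}

module Defs where

open import Level using (_⊔_)
open import Data.Nat using (ℕ; suc)
open import Data.Fin using (Fin)
open import Data.Product using (Σ; _×_)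
open import Relation.Nullary using (¬_)
open import Relation.Binary using (Decidable)
open import Relation.Binary.PropositionalEquality using (_≡_)
open import Algebra.Bundles using (CommutativeRing)
import Algebra.Properties.Monoid.Sum as MonoidSum

record IsField {c ℓ} (F : CommutativeRing c ℓ) : Set (c ⊔ ℓ) where
  open CommutativeRing F
  field
    0≉1 : ¬ (0# ≈ 1#)
    inverse : ∀ x → ¬ (x ≈ 0#) → Σ Carrier (λ y → x * y ≈ 1#)

record HasCardinality {c ℓ} (F : CommutativeRing c ℓ) (q : ℕ) : Set (c ⊔ ℓ) where
  open CommutativeRing F
  field
    enum : Fin q → Carrier
    enum-injective : ∀ i j → enum i ≈ enum j → i ≡ j
    enum-surjective : ∀ x → Σ (Fin q) (λ i → enum i ≈ x)
    _≟_ : Decidable _≈_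

-- The affine geometry AG(n, F) of dimension n over F
-- (as a matroid it has rank r = n + 1).
module AffineGeometry {c ℓ} (F : CommutativeRing c ℓ) (n : ℕ) where
  open CommutativeRing F
  open MonoidSum +-monoid using (sum)

  Point : Set c
  Point = Fin n → Carrier

  dot : Point → Point → Carrier
  dot a x = sum (λ i → a i * x i)

  AffinelyIndependent : ∀ {m} → (Fin m → Point) → Set (c ⊔ ℓ)
  AffinelyIndependent {m} p =
    (λs : Fin m → Carrier) →
    sum λs ≈ 0# →
    (∀ j → sum (λ i → λs i * p i j) ≈ 0#) →
    ∀ i → λs i ≈ 0#

  -- A basis of the matroid AG(n, F) (rank n+1): a maximal independent set,
  -- i.e. n + 1 affinely independent points.
  IsBasis : (Fin (suc n) → Point) → Set (c ⊔ ℓ)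
  IsBasis = AffinelyIndependent

  -- A hyperplane of AG(n, F) (flat of rank n, i.e. affine subspace of
  -- dimension n-1), presented by an equation  a · x = b  with a ≠ 0.
  record Hyperplane : Set (c ⊔ ℓ) where
    constructor hyperplane
    field
      normal : Point
      normal≢0 : ¬ (∀ i → normal i ≈ 0#)
      offset : Carrier

  _∈H_ : Point → Hyperplane → Set ℓ
  x ∈H H = dot (Hyperplane.normal H) x ≈ Hyperplane.offset H

  SameHyperplane : Hyperplane → Hyperplane → Set (c ⊔ ℓ)
  SameHyperplane H H' = ∀ x → (x ∈H H → x ∈H H') × (x ∈H H' → x ∈H H)

  Avoids : ∀ {m} → (Fin m → Point) → Hyperplane → Set ℓ
  Avoids B H = ∀ i → ¬ (B i ∈H H)

{-# OPTIONS --safe #-}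
module Submission where

-- Let B₀, …, Bₙ be the basis and eᵢ = Bᵢ₊₁ − B₀. Affine independence makes the eᵢ linearly
-- independent, and since Fⁿ is finite the injective maps l ↦ Σ lᵢ eᵢ and a ↦ (a · eᵢ)ᵢ of Fⁿ to
-- itself are onto. So every point is B₀ + Σ lᵢ eᵢ, and on it the equation a · x − b of a hyperplane
-- takes the value c + Σ lᵢ (a · eᵢ), where c is its value at B₀. If the hyperplane avoids B then
-- c ≠ 0, and we scale to c = 1; the values dᵢ at Bᵢ₊₁ are then nonzero and not all 1 (otherwise
-- a · eᵢ = 0 for all i, so a = 0). Conversely each such d comes from a hyperplane, which is unique
-- because on the line B₀ + s eᵢ the root of 1 + s (dᵢ − 1) determines dᵢ. Hence the hyperplanes
-- avoiding B correspond to (F^×)ⁿ ∖ {(1, …, 1)}, which has (q − 1)ⁿ − 1 elements.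

open import Defs
open import Level using (_⊔_)
open import Function using (_∘_)
open import Data.Nat as ℕ using (ℕ; zero; suc; _∸_; _^_; _≤_; z≤n; s≤s)
open import Data.Nat.Properties as ℕ using (n<1+n; m∸n+n≡m; m^n>0)
open import Data.Fin as Fin using (Fin; zero; suc; punchIn; punchOut; funToFin; finToFun)
open import Data.Fin.Properties using (any?; pigeonhole; <⇒≢; punchIn-injective; punchInᵢ≢i; punchOut-injective)
open import Data.Fin.Properties using (punchIn-punchOut; funToFin-finToFin; finToFun-funToFin)
open import Data.Product using (Σ; _×_; _,_; proj₁; proj₂)
open import Data.Product.Properties using (≡-dec)
open import Data.Maybe using (just; nothing)
open import Data.Empty using (⊥-elim)
open import Relation.Nullary using (¬_; yes; no)
open import Relation.Binary.Bundles using (Setoid)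
open import Relation.Binary.Definitions using (Decidable; WeaklyDecidable)
open import Relation.Binary.PropositionalEquality as ≡ using (_≡_; _≗_)
open import Algebra.Bundles using (CommutativeRing; RawRing)
open import Algebra.Solver.Ring.AlmostCommutativeRing using (_-Raw-AlmostCommutative⟶_; Induced-equivalence; fromCommutativeRing)
import Algebra.Properties.Semiring.Mult as SemiringMult
import Algebra.Properties.Semiring.Sum as SemiringSum
import Algebra.Properties.Ring as RingProperties
import Algebra.Properties.AbelianGroup as AbelianGroupProperties
import Algebra.Solver.CommutativeMonoid as CommutativeMonoidSolver
import Algebra.Solver.Ring as RingSolver
import Relation.Binary.Construct.On as On
import Data.Vec.Functional.Relation.Binary.Equality.Setoid as PointwiseEquality

-- The ring solver only cancels terms whose coefficients it can compare by computation. For an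
-- arbitrary commutative ring we use integer coefficients, as pairs (m , n) standing for m·1 − n·1,
-- kept normalised (one component zero) so that equal integers are equal pairs.
module IntegerCoefficientSolver {c ℓ} (F : CommutativeRing c ℓ) where
  open CommutativeRing F
  open SemiringMult semiring using (×-homo-+; ×1-homo-*) renaming (_×_ to _·_)
  open RingProperties ring using (x[y-z]≈xy-xz; [y-z]x≈yx-zx)
  open AbelianGroupProperties +-abelianGroup using (⁻¹-∙-comm; ⁻¹-anti-homo‿-; ε⁻¹≈ε)
  open CommutativeMonoidSolver +-commutativeMonoid using (solve; _⊜_; _⊕_)
  open import Relation.Binary.Reasoning.Setoid setoid

  private
    normalise : ℕ → ℕ → ℕ × ℕ
    normalise m n = m ℕ.∸ n , n ℕ.∸ m

    ℤ-rawRing : RawRing _ _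
    ℤ-rawRing = record
      { Carrier = ℕ × ℕ ; _≈_ = _≡_
      ; _+_ = λ { (a , b) (c , d) → normalise (a ℕ.+ c) (b ℕ.+ d) }
      ; _*_ = λ { (a , b) (c , d) → normalise (a ℕ.* c ℕ.+ b ℕ.* d) (a ℕ.* d ℕ.+ b ℕ.* c) }
      ; -_ = λ { (a , b) → b , a }
      ; 0# = 0 , 0 ; 1# = 1 , 0 }

    ι : ℕ → Carrier
    ι n = n · 1#

    ⟦_⟧ : ℕ × ℕ → Carrier
    ⟦ m , n ⟧ = ι m - ι n

    interchange : ∀ w x y z → (w + x) + (y + z) ≈ (w + y) + (x + z)
    interchange = solve 4 (λ w x y z → (w ⊕ x) ⊕ (y ⊕ z) ⊜ (w ⊕ y) ⊕ (x ⊕ z)) refl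

    sub-+ : ∀ a b c d → (a + c) - (b + d) ≈ (a - b) + (c - d)
    sub-+ a b c d = begin
      (a + c) - (b + d)     ≈⟨ +-congˡ (⁻¹-∙-comm b d) ⟨
      (a + c) + (- b + - d) ≈⟨ interchange a c (- b) (- d) ⟩
      (a - b) + (c - d)     ∎

    sub-* : ∀ a b c d → (a - b) * (c - d) ≈ (a * c + b * d) - (a * d + b * c)
    sub-* a b c d = begin
      (a - b) * (c - d)                     ≈⟨ [y-z]x≈yx-zx (c - d) a b ⟩
      a * (c - d) - b * (c - d)             ≈⟨ +-cong (x[y-z]≈xy-xz a c d) (-‿cong (x[y-z]≈xy-xz b c d)) ⟩
      (a * c - a * d) - (b * c - b * d)     ≈⟨ +-congˡ (⁻¹-anti-homo‿- (b * c) (b * d)) ⟩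
      (a * c - a * d) + (b * d - b * c)     ≈⟨ interchange (a * c) (- (a * d)) (b * d) (- (b * c)) ⟩
      (a * c + b * d) + (- (a * d) - b * c) ≈⟨ +-congˡ (⁻¹-∙-comm (a * d) (b * c)) ⟩
      (a * c + b * d) - (a * d + b * c)     ∎

    normalise-sound : ∀ m n → ⟦ normalise m n ⟧ ≈ ι m - ι n
    normalise-sound zero    zero    = refl
    normalise-sound zero    (suc n) = refl
    normalise-sound (suc m) zero    = refl
    normalise-sound (suc m) (suc n) = begin
      ⟦ normalise m n ⟧         ≈⟨ normalise-sound m n ⟩
      ι m - ι n                 ≈⟨ +-identityˡ _ ⟨
      0# + (ι m - ι n)          ≈⟨ +-congʳ (-‿inverseʳ 1#) ⟨
      (1# - 1#) + (ι m - ι n)   ≈⟨ sub-+ 1# 1# (ι m) (ι n) ⟨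
      ι (suc m) - ι (suc n)     ∎

    ι-+-* : ∀ a c b d → ι (a ℕ.* c ℕ.+ b ℕ.* d) ≈ ι a * ι c + ι b * ι d
    ι-+-* a c b d = trans (×-homo-+ 1# (a ℕ.* c) (b ℕ.* d)) (+-cong (×1-homo-* a c) (×1-homo-* b d))

    morphism : ℤ-rawRing -Raw-AlmostCommutative⟶ fromCommutativeRing F
    morphism = record
      { ⟦_⟧ = ⟦_⟧
      ; +-homo = λ { (a , b) (c , d) → begin
          ⟦ normalise (a ℕ.+ c) (b ℕ.+ d) ⟧ ≈⟨ normalise-sound (a ℕ.+ c) (b ℕ.+ d) ⟩
          ι (a ℕ.+ c) - ι (b ℕ.+ d)         ≈⟨ +-cong (×-homo-+ 1# a c) (-‿cong (×-homo-+ 1# b d)) ⟩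
          (ι a + ι c) - (ι b + ι d)         ≈⟨ sub-+ (ι a) (ι b) (ι c) (ι d) ⟩
          ⟦ a , b ⟧ + ⟦ c , d ⟧             ∎ }
      ; *-homo = λ { (a , b) (c , d) → begin
          ⟦ normalise (a ℕ.* c ℕ.+ b ℕ.* d) (a ℕ.* d ℕ.+ b ℕ.* c) ⟧
            ≈⟨ normalise-sound (a ℕ.* c ℕ.+ b ℕ.* d) (a ℕ.* d ℕ.+ b ℕ.* c) ⟩
          ι (a ℕ.* c ℕ.+ b ℕ.* d) - ι (a ℕ.* d ℕ.+ b ℕ.* c)
            ≈⟨ +-cong (ι-+-* a c b d) (-‿cong (ι-+-* a d b c)) ⟩
          (ι a * ι c + ι b * ι d) - (ι a * ι d + ι b * ι c)
            ≈⟨ sub-* (ι a) (ι b) (ι c) (ι d) ⟨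
          ⟦ a , b ⟧ * ⟦ c , d ⟧ ∎ }
      ; -‿homo = λ { (a , b) → sym (⁻¹-anti-homo‿- (ι a) (ι b)) }
      ; 0-homo = -‿inverseʳ 0#
      ; 1-homo = trans (+-cong (+-identityʳ 1#) ε⁻¹≈ε) (+-identityʳ 1#)
      }

    _≟ℤ_ : WeaklyDecidable (Induced-equivalence morphism)
    x ≟ℤ y with ≡-dec ℕ._≟_ ℕ._≟_ x y
    ... | yes ≡.refl = just refl
    ... | no _       = nothing

  open RingSolver ℤ-rawRing (fromCommutativeRing F) morphism _≟ℤ_ public
    using (solve; _:=_; _:+_; _:*_; :-_; _:-_)

-- Finite enumerations

Fin-injective⇒surjective : ∀ {m} (g : Fin m → Fin m) → (∀ i j → g i ≡ g j → i ≡ j) →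
                           ∀ y → Σ (Fin m) (λ x → g x ≡ y)
Fin-injective⇒surjective {zero}  g g-injective ()
Fin-injective⇒surjective {suc m} g g-injective y with any? (λ x → g x Fin.≟ y)
... | yes hit = hit
... | no miss with pigeonhole (n<1+n m) (λ x → punchOut {i = y} {j = g x} (λ y≡gx → miss (x , ≡.sym y≡gx)))
...   | i , j , i<j , same = ⊥-elim (<⇒≢ i<j (g-injective i j (punchOut-injective {i = y} _ _ same)))

funToFin-cong : ∀ {m n} {f g : Fin m → Fin n} → f ≗ g → funToFin f ≡ funToFin g
funToFin-cong {zero}  f≗g = ≡.refl
funToFin-cong {suc m} f≗g = ≡.cong₂ Fin.combine (f≗g zero) (funToFin-cong (λ i → f≗g (suc i)))

record Enumeration {a r} (S : Setoid a r) (m : ℕ) : Set (a ⊔ r) where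
  open Setoid S
  field
    enum : Fin m → Carrier
    enum-injective : ∀ i j → enum i ≈ enum j → i ≡ j
    enum-surjective : ∀ x → Σ (Fin m) (λ i → enum i ≈ x)

  index : Carrier → Fin m
  index x = proj₁ (enum-surjective x)

  enum-index : ∀ x → enum (index x) ≈ x
  enum-index x = proj₂ (enum-surjective x)

  index-injective : ∀ {x y} → index x ≡ index y → x ≈ y
  index-injective {x} {y} eq =
    trans (sym (enum-index x)) (≡.subst (λ i → enum i ≈ y) (≡.sym eq) (enum-index y))

  injective⇒surjective : (f : Carrier → Carrier) → (∀ {x y} → f x ≈ f y → x ≈ y) →
                         ∀ y → Σ Carrier (λ x → f x ≈ y)
  injective⇒surjective f f-injective y =
    let k , gk≡y = Fin-injective⇒surjective g g-injective (index y) in enum k , index-injective gk≡y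
    where
    g : Fin m → Fin m
    g i = index (f (enum i))
    g-injective : ∀ i j → g i ≡ g j → i ≡ j
    g-injective i j eq = enum-injective i j (f-injective (index-injective eq))

_∖_ : ∀ {a r} (S : Setoid a r) → Setoid.Carrier S → Setoid (a ⊔ r) r
S ∖ x₀ = On.setoid {B = Σ Carrier (λ x → ¬ x ≈ x₀)} S proj₁
  where open Setoid S

module _ {a r} {S : Setoid a r} where
  open Setoid S
  open Enumeration
  open PointwiseEquality S using (≋-setoid)

  without : ∀ {m} → Enumeration S (suc m) → (x₀ : Carrier) → Enumeration (S ∖ x₀) m
  without {m} E x₀ = record
    { enum = λ i → enum E (punchIn z i) , λ e → punchInᵢ≢i z i (enum-injective E _ _ (trans e (sym (enum-index E x₀))))
    ; enum-injective = λ i j e → punchIn-injective z i j (enum-injective E _ _ e)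
    ; enum-surjective = λ (x , x≉x₀) → let z≢k = λ e → x≉x₀ (index-injective E (≡.sym e)) in
        punchOut z≢k , ≡.subst (λ i → enum E i ≈ x) (≡.sym (punchIn-punchOut z≢k)) (enum-index E x)
    }
    where
    z = index E x₀

  pointwise : ∀ {m} → Enumeration S m → ∀ n → Enumeration (≋-setoid n) (m ^ n)
  pointwise {m} E n = record
    { enum = λ k i → enum E (finToFun k i)
    ; enum-injective = λ k l e → ≡.trans (≡.sym (funToFin-finToFin {n} {m} k))
        (≡.trans (funToFin-cong (λ i → enum-injective E _ _ (e i))) (funToFin-finToFin {n} {m} l))
    ; enum-surjective = λ x → funToFin (λ i → index E (x i)) , λ i →
        ≡.subst (λ j → enum E j ≈ x i) (≡.sym (finToFun-funToFin (λ i → index E (x i)) i)) (enum-index E (x i))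
    }

-- Linear algebra in Fⁿ

module LinearAlgebra {c ℓ} (F : CommutativeRing c ℓ) where
  open CommutativeRing F hiding (zero)
  open SemiringSum semiring
    using (sum; sum-cong-≋; sum-replicate-zero; ∑-distrib-+; ∑-comm; *-distribˡ-sum; *-distribʳ-sum)
  open IntegerCoefficientSolver F
  open RingProperties ring using (-‿distribˡ-*)
  open AbelianGroupProperties +-abelianGroup using (x∙y⁻¹≈ε⇒x≈y; identityˡ-unique)
  open PointwiseEquality setoid using (_≋_; ≋-setoid)
  open import Relation.Binary.Reasoning.Setoid setoid

  Vector : ℕ → Set c
  Vector n = Fin n → Carrier

  dot : ∀ {n} → Vector n → Vector n → Carrier
  dot {n} = AffineGeometry.dot F n

  lincomb : ∀ {m n} → Vector m → (Fin m → Vector n) → Vector n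
  lincomb l w k = sum (λ i → l i * w i k)

  unit : ∀ {n} → Fin n → Vector n
  unit zero    zero    = 1#
  unit zero    (suc _) = 0#
  unit (suc _) zero    = 0#
  unit (suc i) (suc j) = unit i j

  LinearlyIndependent : ∀ {m n} → (Fin m → Vector n) → Set (c ⊔ ℓ)
  LinearlyIndependent w = ∀ l → lincomb l w ≋ (λ _ → 0#) → ∀ i → l i ≈ 0#

  Spans : ∀ {m n} → (Fin m → Vector n) → Set (c ⊔ ℓ)
  Spans {m} w = ∀ x → Σ (Vector m) (λ l → lincomb l w ≋ x)

  sum-zero : ∀ {n} {f : Vector n} → (∀ i → f i ≈ 0#) → sum f ≈ 0#
  sum-zero {n} f≈0 = trans (sum-cong-≋ f≈0) (sum-replicate-zero n)

  dot-comm : ∀ {n} (x y : Vector n) → dot x y ≈ dot y x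
  dot-comm x y = sum-cong-≋ (λ i → *-comm (x i) (y i))

  dot-congˡ : ∀ {n} {x x′ : Vector n} (y : Vector n) → x ≋ x′ → dot x y ≈ dot x′ y
  dot-congˡ y x≋x′ = sum-cong-≋ (λ i → *-congʳ (x≋x′ i))

  dot-congʳ : ∀ {n} (x : Vector n) {y y′ : Vector n} → y ≋ y′ → dot x y ≈ dot x y′
  dot-congʳ x y≋y′ = sum-cong-≋ (λ i → *-congˡ (y≋y′ i))

  dot-zeroˡ : ∀ {n} (y : Vector n) → dot (λ _ → 0#) y ≈ 0#
  dot-zeroˡ y = sum-zero (λ i → zeroˡ (y i))

  dot-*ˡ : ∀ {n} s (x y : Vector n) → dot (λ i → s * x i) y ≈ s * dot x y
  dot-*ˡ s x y =
    trans (sum-cong-≋ (λ i → *-assoc s (x i) (y i))) (sym (*-distribˡ-sum s (λ i → x i * y i)))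

  dot-*ʳ : ∀ {n} s (x y : Vector n) → dot x (λ i → s * y i) ≈ s * dot x y
  dot-*ʳ s x y = trans (dot-comm x _) (trans (dot-*ˡ s y x) (*-congˡ (dot-comm y x)))

  dot-+ʳ : ∀ {n} (x y z : Vector n) → dot x (λ i → y i + z i) ≈ dot x y + dot x z
  dot-+ʳ x y z =
    trans (sum-cong-≋ (λ i → distribˡ (x i) (y i) (z i))) (∑-distrib-+ (λ i → x i * y i) (λ i → x i * z i))

  dot-unitˡ : ∀ {n} (i : Fin n) (y : Vector n) → dot (unit i) y ≈ y i
  dot-unitˡ zero y = begin
    1# * y zero + sum (λ j → 0# * y (suc j))
      ≈⟨ +-cong (*-identityˡ (y zero)) (sum-zero (λ j → zeroˡ (y (suc j)))) ⟩
    y zero + 0#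
      ≈⟨ +-identityʳ (y zero) ⟩
    y zero ∎
  dot-unitˡ (suc i) y = begin
    0# * y zero + dot (unit i) (λ j → y (suc j))
      ≈⟨ +-cong (zeroˡ (y zero)) (dot-unitˡ i (λ j → y (suc j))) ⟩
    0# + y (suc i)
      ≈⟨ +-identityˡ (y (suc i)) ⟩
    y (suc i) ∎

  dot-unitʳ : ∀ {n} (x : Vector n) (i : Fin n) → dot x (unit i) ≈ x i
  dot-unitʳ x i = trans (dot-comm x (unit i)) (dot-unitˡ i x)

  dot-lincomb : ∀ {m n} (x : Vector n) (l : Vector m) (w : Fin m → Vector n) →
                dot x (lincomb l w) ≈ dot l (λ i → dot x (w i))
  dot-lincomb x l w = begin
    sum (λ k → x k * sum (λ i → l i * w i k))
      ≈⟨ sum-cong-≋ (λ k → *-distribˡ-sum (x k) (λ i → l i * w i k)) ⟩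
    sum (λ k → sum (λ i → x k * (l i * w i k)))
      ≈⟨ ∑-comm (λ k i → x k * (l i * w i k)) ⟩
    sum (λ i → sum (λ k → x k * (l i * w i k)))
      ≈⟨ sum-cong-≋ (λ i → sum-cong-≋ (λ k → x[yz]≈y[xz] (x k) (l i) (w i k))) ⟩
    sum (λ i → sum (λ k → l i * (x k * w i k)))
      ≈⟨ sum-cong-≋ (λ i → *-distribˡ-sum (l i) (λ k → x k * w i k)) ⟨
    sum (λ i → l i * dot x (w i)) ∎
    where
    x[yz]≈y[xz] : ∀ a b d → a * (b * d) ≈ b * (a * d)
    x[yz]≈y[xz] = solve 3 (λ a b d → a :* (b :* d) := b :* (a :* d)) refl

  lincomb-injective : ∀ {m n} {w : Fin m → Vector n} → LinearlyIndependent w →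
                      ∀ {l l′} → lincomb l w ≋ lincomb l′ w → ∀ i → l i ≈ l′ i
  lincomb-injective {w = w} independent {l} {l′} same i =
    x∙y⁻¹≈ε⇒x≈y (l i) (l′ i) (independent δ δw≈0 i)
    where
    δ = λ i → l i - l′ i
    δw≈0 : lincomb δ w ≋ (λ _ → 0#)
    δw≈0 k = identityˡ-unique (lincomb δ w k) (lincomb l′ w k) (begin
      lincomb δ w k + lincomb l′ w k
        ≈⟨ ∑-distrib-+ (λ i → δ i * w i k) (λ i → l′ i * w i k) ⟨
      sum (λ i → δ i * w i k + l′ i * w i k)
        ≈⟨ sum-cong-≋ (λ i → solve 3 (λ a b x → (a :- b) :* x :+ b :* x := a :* x) refl (l i) (l′ i) (w i k)) ⟩
      lincomb l w k
        ≈⟨ same k ⟩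
      lincomb l′ w k ∎)

  -- Over a finite ring, injective self-maps of Fⁿ are onto; this replaces dimension theory.
  module _ {q} (scalars : Enumeration setoid q) {n} {w : Fin n → Vector n} where
    open Enumeration (pointwise scalars n) using (injective⇒surjective)

    independent⇒spans : LinearlyIndependent w → Spans w
    independent⇒spans independent =
      injective⇒surjective (λ l → lincomb l w) (lincomb-injective independent)

    spans⇒dual-injective : Spans w → ∀ {x y} → (∀ i → dot x (w i) ≈ dot y (w i)) → x ≋ y
    spans⇒dual-injective spans {x} {y} same k = begin
      x k                       ≈⟨ dot-unitʳ x k ⟨
      dot x (unit k)            ≈⟨ dot-congʳ x l≋unit ⟨
      dot x (lincomb l w)       ≈⟨ dot-lincomb x l w ⟩
      dot l (λ i → dot x (w i)) ≈⟨ dot-congʳ l same ⟩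
      dot l (λ i → dot y (w i)) ≈⟨ dot-lincomb y l w ⟨
      dot y (lincomb l w)       ≈⟨ dot-congʳ y l≋unit ⟩
      dot y (unit k)            ≈⟨ dot-unitʳ y k ⟩
      y k                       ∎
      where
      l = proj₁ (spans (unit k))
      l≋unit = proj₂ (spans (unit k))

    spans⇒dual-surjective : Spans w → ∀ d → Σ (Vector n) (λ x → ∀ i → dot x (w i) ≈ d i)
    spans⇒dual-surjective spans =
      injective⇒surjective (λ x i → dot x (w i)) (spans⇒dual-injective spans)

  differences : ∀ {m n} → (Fin (suc m) → Vector n) → Fin m → Vector n
  differences B i k = B (suc i) k - B zero k

  affinelyIndependent⇒differencesIndependent : ∀ {m n} {B : Fin (suc m) → Vector n} →
    AffineGeometry.AffinelyIndependent F n B → LinearlyIndependent (differences B)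
  affinelyIndependent⇒differencesIndependent {B = B} independent l l·e≈0 i =
    independent λs (-‿inverseˡ (sum l)) λB≈0 (suc i)
    where
    λs : Vector _
    λs zero    = - sum l
    λs (suc i) = l i
    λB≈0 : ∀ k → sum (λ j → λs j * B j k) ≈ 0#
    λB≈0 k = begin
      - sum l * b + sum (λ i → l i * B (suc i) k)
        ≈⟨ +-congˡ (sum-cong-≋ (λ i → solve 3 (λ a x y → a :* x := a :* (x :- y) :+ a :* y) refl (l i) (B (suc i) k) b)) ⟩
      - sum l * b + sum (λ i → l i * differences B i k + l i * b)
        ≈⟨ +-congˡ (∑-distrib-+ (λ i → l i * differences B i k) (λ i → l i * b)) ⟩
      - sum l * b + (lincomb l (differences B) k + sum (λ i → l i * b))
        ≈⟨ +-congˡ (+-cong (l·e≈0 k) (sym (*-distribʳ-sum b l))) ⟩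
      - sum l * b + (0# + sum l * b)
        ≈⟨ +-cong (-‿distribˡ-* (sum l) b) (sym (+-identityˡ (sum l * b))) ⟨
      - (sum l * b) + sum l * b
        ≈⟨ -‿inverseˡ (sum l * b) ⟩
      0# ∎
      where b = B zero k

module FieldLemmas {c ℓ} (F : CommutativeRing c ℓ) (isField : IsField F) where
  open CommutativeRing F hiding (zero)
  open IsField isField
  open IntegerCoefficientSolver F
  open AbelianGroupProperties +-abelianGroup using (x∙y⁻¹≈ε⇒x≈y)
  open import Relation.Binary.Reasoning.Setoid setoid

  cardinality≥2 : ∀ {q} → HasCardinality F q → 2 ≤ q
  cardinality≥2 {zero} card with HasCardinality.enum-surjective card 0#
  ... | () , _
  cardinality≥2 {suc zero} card with HasCardinality.enum-surjective card 0# | HasCardinality.enum-surjective card 1#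
  ... | zero , enum≈0 | zero , enum≈1 = ⊥-elim (0≉1 (trans (sym enum≈0) enum≈1))
  cardinality≥2 {suc (suc _)} _ = s≤s (s≤s z≤n)

  invertible⇒x*y≈0⇒y≈0 : ∀ {u x y} → u * x ≈ 1# → x * y ≈ 0# → y ≈ 0#
  invertible⇒x*y≈0⇒y≈0 {u} {x} {y} ux≈1 xy≈0 = begin
    y           ≈⟨ *-identityˡ y ⟨
    1# * y      ≈⟨ *-congʳ ux≈1 ⟨
    (u * x) * y ≈⟨ *-assoc u x y ⟩
    u * (x * y) ≈⟨ *-congˡ xy≈0 ⟩
    u * 0#      ≈⟨ zeroʳ u ⟩
    0#          ∎

  -- s = − a⁻¹ is a root of 1 + s a, hence of 1 + s b.
  root-determines-slope : ∀ a b → ¬ a ≈ 0# → (∀ s → 1# + s * a ≈ 0# → 1# + s * b ≈ 0#) → a ≈ b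
  root-determines-slope a b a≉0 same-root = begin
    a           ≈⟨ *-identityʳ a ⟨
    a * 1#      ≈⟨ *-congˡ tb≈1 ⟨
    a * (t * b) ≈⟨ *-assoc a t b ⟨
    (a * t) * b ≈⟨ *-congʳ at≈1 ⟩
    1# * b      ≈⟨ *-identityˡ b ⟩
    b           ∎
    where
    t = proj₁ (inverse a a≉0)
    at≈1 = proj₂ (inverse a a≉0)
    1-tx : ∀ x → 1# + (- t) * x ≈ 1# - t * x
    1-tx = solve 3 (λ o t x → o :+ (:- t) :* x := o :- t :* x) refl 1# t
    tb≈1 : t * b ≈ 1#
    tb≈1 = sym (x∙y⁻¹≈ε⇒x≈y 1# (t * b) (trans (sym (1-tx b)) (same-root (- t) (begin
      1# + (- t) * a ≈⟨ 1-tx a ⟩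
      1# - t * a     ≈⟨ +-congˡ (-‿cong (trans (*-comm t a) at≈1)) ⟩
      1# - 1#        ≈⟨ -‿inverseʳ 1# ⟩
      0#             ∎))))

  same-roots⇒same-slope : Decidable _≈_ → ∀ a b →
    (∀ s → (1# + s * a ≈ 0# → 1# + s * b ≈ 0#) × (1# + s * b ≈ 0# → 1# + s * a ≈ 0#)) → a ≈ b
  same-roots⇒same-slope _≟_ a b same-roots with a ≟ 0# | b ≟ 0#
  ... | no a≉0  | _       = root-determines-slope a b a≉0 (λ s → proj₁ (same-roots s))
  ... | yes a≈0 | yes b≈0 = trans a≈0 (sym b≈0)
  ... | yes _   | no b≉0  = sym (root-determines-slope b a b≉0 (λ s → proj₂ (same-roots s)))

-- Hyperplanes avoiding a basis

module AvoidingHyperplanes {c ℓ} (F : CommutativeRing c ℓ) (isField : IsField F) {q} (card : HasCardinality F q)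
  (n : ℕ) (B : Fin (suc n) → Fin n → CommutativeRing.Carrier F) (basis : AffineGeometry.IsBasis F n B) where
  open CommutativeRing F hiding (zero)
  open IsField isField
  open HasCardinality card using (_≟_)
  open AffineGeometry F n using (Point; Hyperplane; hyperplane; _∈H_; SameHyperplane; Avoids)
  open Hyperplane
  open LinearAlgebra F
  open FieldLemmas F isField
  open IntegerCoefficientSolver F
  open PointwiseEquality setoid using (_≋_)
  open PointwiseEquality (setoid ∖ 0#) using (≋-setoid)
  open AbelianGroupProperties +-abelianGroup using (x∙y⁻¹≈ε⇒x≈y; x≈y⇒x∙y⁻¹≈ε; ∙-cancelʳ)
  open import Relation.Binary.Reasoning.Setoid setoid

  scalars : Enumeration setoid q
  scalars = record { HasCardinality card }

  edges : Fin n → Point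
  edges = differences B

  edges-span : Spans edges
  edges-span = independent⇒spans scalars (affinelyIndependent⇒differencesIndependent {B = B} basis)

  atCoordinates : Vector n → Point
  atCoordinates l k = B zero k + lincomb l edges k

  atCoordinates-surjective : ∀ x → Σ (Vector n) (λ l → atCoordinates l ≋ x)
  atCoordinates-surjective x =
    l , λ k → trans (+-congˡ (l·e≋x-B₀ k)) (solve 2 (λ b y → b :+ (y :- b) := y) refl (B zero k) (x k))
    where
    l = proj₁ (edges-span (λ k → x k - B zero k))
    l·e≋x-B₀ = proj₂ (edges-span (λ k → x k - B zero k))

  value : Hyperplane → Point → Carrier
  value H x = dot (normal H) x - offset H

  ∈⇒value≈0 : ∀ {H x} → x ∈H H → value H x ≈ 0#
  ∈⇒value≈0 = x≈y⇒x∙y⁻¹≈ε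

  value≈0⇒∈ : ∀ {H x} → value H x ≈ 0# → x ∈H H
  value≈0⇒∈ = x∙y⁻¹≈ε⇒x≈y _ _

  value-cong : ∀ H {x y} → x ≋ y → value H x ≈ value H y
  value-cong H x≋y = +-congʳ (dot-congʳ (normal H) x≋y)

  slopes : Hyperplane → Vector n
  slopes H i = dot (normal H) (edges i)

  value-atCoordinates : ∀ H l → value H (atCoordinates l) ≈ value H (B zero) + dot l (slopes H)
  value-atCoordinates H l = begin
    dot a (atCoordinates l) - o                    ≈⟨ +-congʳ (dot-+ʳ a (B zero) (lincomb l edges)) ⟩
    (dot a (B zero) + dot a (lincomb l edges)) - o ≈⟨ +-congʳ (+-congˡ (dot-lincomb a l edges)) ⟩
    (dot a (B zero) + dot l (slopes H)) - o
      ≈⟨ solve 3 (λ y s o → (y :+ s) :- o := (y :- o) :+ s) refl (dot a (B zero)) (dot l (slopes H)) o ⟩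
    value H (B zero) + dot l (slopes H)            ∎
    where
    a = normal H
    o = offset H

  value-basis : ∀ H i → value H (B (suc i)) ≈ value H (B zero) + slopes H i
  value-basis H i = begin
    value H (B (suc i))                        ≈⟨ value-cong H B≋unit ⟩
    value H (atCoordinates (unit i))           ≈⟨ value-atCoordinates H (unit i) ⟩
    value H (B zero) + dot (unit i) (slopes H) ≈⟨ +-congˡ (dot-unitˡ i (slopes H)) ⟩
    value H (B zero) + slopes H i              ∎
    where
    B≋unit : B (suc i) ≋ atCoordinates (unit i)
    B≋unit k = sym (trans (+-congˡ (dot-unitˡ i (λ j → edges j k)))
                          (solve 2 (λ b x → b :+ (x :- b) := x) refl (B zero k) (B (suc i) k)))

  line : Fin n → Carrier → Point
  line i s = atCoordinates (λ j → s * unit i j)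

  value-line : ∀ H i s → value H (line i s) ≈ value H (B zero) + s * slopes H i
  value-line H i s = trans (value-atCoordinates H _)
    (+-congˡ (trans (dot-*ˡ s (unit i) (slopes H)) (*-congˡ (dot-unitˡ i (slopes H)))))

  slopes≈0⇒normal≈0 : ∀ H → (∀ i → slopes H i ≈ 0#) → ∀ k → normal H k ≈ 0#
  slopes≈0⇒normal≈0 H slopes≈0 =
    spans⇒dual-injective scalars edges-span (λ i → trans (slopes≈0 i) (sym (dot-zeroˡ (edges i))))

  proportional⇒same : ∀ {H H′ u t} → u * t ≈ 1# → (∀ x → value H′ x ≈ t * value H x) → SameHyperplane H H′
  proportional⇒same {H} {H′} {t = t} ut≈1 proportional x =
    (λ x∈H → value≈0⇒∈ {H′} (trans (proportional x) (trans (*-congˡ (∈⇒value≈0 {H} x∈H)) (zeroʳ t)))) ,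
    (λ x∈H′ → value≈0⇒∈ {H} (invertible⇒x*y≈0⇒y≈0 ut≈1 (trans (sym (proportional x)) (∈⇒value≈0 {H′} x∈H′))))

  proportional-on-frame : ∀ H H′ t → value H′ (B zero) ≈ t * value H (B zero) →
    (∀ i → slopes H′ i ≈ t * slopes H i) → ∀ x → value H′ x ≈ t * value H x
  proportional-on-frame H H′ t at-B₀ at-slopes x = begin
    value H′ x                                          ≈⟨ value-cong H′ l≋x ⟨
    value H′ (atCoordinates l)                          ≈⟨ value-atCoordinates H′ l ⟩
    value H′ (B zero) + dot l (slopes H′)               ≈⟨ +-cong at-B₀ (dot-congʳ l at-slopes) ⟩
    t * value H (B zero) + dot l (λ i → t * slopes H i) ≈⟨ +-congˡ (dot-*ʳ t l (slopes H)) ⟩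
    t * value H (B zero) + t * dot l (slopes H)         ≈⟨ distribˡ t _ _ ⟨
    t * (value H (B zero) + dot l (slopes H))           ≈⟨ *-congˡ (value-atCoordinates H l) ⟨
    t * value H (atCoordinates l)                       ≈⟨ *-congˡ (value-cong H l≋x) ⟩
    t * value H x                                       ∎
    where
    l = proj₁ (atCoordinates-surjective x)
    l≋x = proj₂ (atCoordinates-surjective x)

  normalWithSlopes : Vector n → Point
  normalWithSlopes d = proj₁ (spans⇒dual-surjective scalars edges-span d)

  normalWithSlopes-slopes : ∀ d i → dot (normalWithSlopes d) (edges i) ≈ d i
  normalWithSlopes-slopes d = proj₂ (spans⇒dual-surjective scalars edges-span d)

  -- The hyperplane whose equation takes the value 1 at B₀ and dᵢ at Bᵢ₊₁.
  normalised : (d : Vector n) → ¬ (∀ i → d i ≈ 1#) → Hyperplane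
  normalised d d≉1 = hyperplane a a≉0 (dot a (B zero) - 1#)
    where
    a = normalWithSlopes (λ i → d i - 1#)
    a≉0 : ¬ (∀ k → a k ≈ 0#)
    a≉0 a≈0 = d≉1 (λ i → x∙y⁻¹≈ε⇒x≈y (d i) 1#
      (trans (sym (normalWithSlopes-slopes _ i)) (trans (dot-congˡ (edges i) a≈0) (dot-zeroˡ (edges i)))))

  module _ (d : Vector n) (d≉1 : ¬ (∀ i → d i ≈ 1#)) where
    private
      H = normalised d d≉1

    value-normalised-B₀ : value H (B zero) ≈ 1#
    value-normalised-B₀ = solve 2 (λ y o → y :- (y :- o) := o) refl (dot (normal H) (B zero)) 1#

    slopes-normalised : ∀ i → slopes H i ≈ d i - 1#
    slopes-normalised = normalWithSlopes-slopes (λ i → d i - 1#)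

    value-normalised-line : ∀ i s → value H (line i s) ≈ 1# + s * (d i - 1#)
    value-normalised-line i s =
      trans (value-line H i s) (+-cong value-normalised-B₀ (*-congˡ (slopes-normalised i)))

    normalised-avoids : (∀ i → ¬ d i ≈ 0#) → Avoids B H
    normalised-avoids d≉0 zero B₀∈H = 0≉1 (trans (sym (∈⇒value≈0 {H} B₀∈H)) value-normalised-B₀)
    normalised-avoids d≉0 (suc i) Bᵢ₊₁∈H = d≉0 i (begin
      d i                           ≈⟨ solve 2 (λ o d → d := o :+ (d :- o)) refl 1# (d i) ⟩
      1# + (d i - 1#)               ≈⟨ +-cong value-normalised-B₀ (slopes-normalised i) ⟨
      value H (B zero) + slopes H i ≈⟨ value-basis H i ⟨
      value H (B (suc i))           ≈⟨ ∈⇒value≈0 {H} Bᵢ₊₁∈H ⟩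
      0#                            ∎)

  same-sym : ∀ {H H′} → SameHyperplane H H′ → SameHyperplane H′ H
  same-sym same x = proj₂ (same x) , proj₁ (same x)

  same⇒roots : ∀ {H H′} → SameHyperplane H H′ → ∀ x → value H x ≈ 0# → value H′ x ≈ 0#
  same⇒roots {H} {H′} same x root = ∈⇒value≈0 {H′} (proj₁ (same x) (value≈0⇒∈ {H} root))

  same⇒line-roots : ∀ {d d′} (d≉1 : ¬ (∀ i → d i ≈ 1#)) (d′≉1 : ¬ (∀ i → d′ i ≈ 1#)) →
    SameHyperplane (normalised d d≉1) (normalised d′ d′≉1) →
    ∀ i s → 1# + s * (d i - 1#) ≈ 0# → 1# + s * (d′ i - 1#) ≈ 0#
  same⇒line-roots {d} {d′} d≉1 d′≉1 same i s root = trans (sym (value-normalised-line d′ d′≉1 i s))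
    (same⇒roots {normalised d d≉1} {normalised d′ d′≉1} same (line i s)
      (trans (value-normalised-line d d≉1 i s) root))

  normalised-injective : ∀ {d d′} (d≉1 : ¬ (∀ i → d i ≈ 1#)) (d′≉1 : ¬ (∀ i → d′ i ≈ 1#)) →
    SameHyperplane (normalised d d≉1) (normalised d′ d′≉1) → ∀ i → d i ≈ d′ i
  normalised-injective {d} {d′} d≉1 d′≉1 same i =
    ∙-cancelʳ (- 1#) (d i) (d′ i) (same-roots⇒same-slope _≟_ (d i - 1#) (d′ i - 1#) λ s →
      same⇒line-roots d≉1 d′≉1 same i s ,
      same⇒line-roots d′≉1 d≉1 (same-sym {normalised d d≉1} {normalised d′ d′≉1} same) i s)

  module _ (H : Hyperplane) (avoids : Avoids B H) where
    private
      c₀ = value H (B zero)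
      c₀≉0 : ¬ c₀ ≈ 0#
      c₀≉0 c₀≈0 = avoids zero (value≈0⇒∈ {H} c₀≈0)
      t = proj₁ (inverse c₀ c₀≉0)
      c₀t≈1 : c₀ * t ≈ 1#
      c₀t≈1 = proj₂ (inverse c₀ c₀≉0)

    normalisedValues : Vector n
    normalisedValues i = t * value H (B (suc i))

    normalisedValues≉0 : ∀ i → ¬ normalisedValues i ≈ 0#
    normalisedValues≉0 i tv≈0 = avoids (suc i) (value≈0⇒∈ {H} (invertible⇒x*y≈0⇒y≈0 c₀t≈1 tv≈0))

    normalisedValues-1≈scaledSlopes : ∀ i → normalisedValues i - 1# ≈ t * slopes H i
    normalisedValues-1≈scaledSlopes i = begin
      t * value H (B (suc i)) - 1#
        ≈⟨ +-cong (*-congˡ (value-basis H i)) (-‿cong (trans (sym c₀t≈1) (*-comm c₀ t))) ⟩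
      t * (c₀ + slopes H i) - t * c₀
        ≈⟨ solve 3 (λ t c s → t :* (c :+ s) :- t :* c := t :* s) refl t c₀ (slopes H i) ⟩
      t * slopes H i ∎

    normalisedValues≉1 : ¬ (∀ i → normalisedValues i ≈ 1#)
    normalisedValues≉1 all≈1 = normal≢0 H (slopes≈0⇒normal≈0 H (λ i → invertible⇒x*y≈0⇒y≈0 c₀t≈1
      (trans (sym (normalisedValues-1≈scaledSlopes i)) (x≈y⇒x∙y⁻¹≈ε (all≈1 i)))))

    same-normalised : ∀ d (d≉1 : ¬ (∀ i → d i ≈ 1#)) → (∀ i → d i ≈ normalisedValues i) →
                      SameHyperplane H (normalised d d≉1)
    same-normalised d d≉1 d≈ = proportional⇒same {H} {normalised d d≉1} c₀t≈1
      (proportional-on-frame H (normalised d d≉1) t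
        (trans (value-normalised-B₀ d d≉1) (trans (sym c₀t≈1) (*-comm c₀ t)))
        (λ i → trans (slopes-normalised d d≉1 i) (trans (+-congʳ (d≈ i)) (normalisedValues-1≈scaledSlopes i))))

  allOnes : Setoid.Carrier (≋-setoid n)
  allOnes _ = 1# , λ 1≈0 → 0≉1 (sym 1≈0)

  Profiles : Setoid (c ⊔ ℓ) ℓ
  Profiles = ≋-setoid n ∖ allOnes

  hyperplaneOf : Setoid.Carrier Profiles → Hyperplane
  hyperplaneOf (d , d≉1) = normalised (λ i → proj₁ (d i)) d≉1

  hyperplaneOf-avoids : ∀ p → Avoids B (hyperplaneOf p)
  hyperplaneOf-avoids (d , d≉1) = normalised-avoids _ d≉1 (λ i → proj₂ (d i))

  hyperplaneOf-injective : ∀ p p′ → SameHyperplane (hyperplaneOf p) (hyperplaneOf p′) → Setoid._≈_ Profiles p p′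
  hyperplaneOf-injective (_ , d≉1) (_ , d′≉1) = normalised-injective d≉1 d′≉1

  profileOf : ∀ H → Avoids B H → Setoid.Carrier Profiles
  profileOf H avoids =
    (λ i → normalisedValues H avoids i , normalisedValues≉0 H avoids i) , normalisedValues≉1 H avoids

  same-hyperplaneOf-profileOf : ∀ H (avoids : Avoids B H) p → Setoid._≈_ Profiles p (profileOf H avoids) →
                                SameHyperplane H (hyperplaneOf p)
  same-hyperplaneOf-profileOf H avoids (_ , d≉1) = same-normalised H avoids _ d≉1

  profiles : 2 ≤ q → Enumeration Profiles ((q ∸ 1) ^ n ∸ 1)
  profiles (s≤s (s≤s {n = q′} _)) = without nonZeroTuples allOnes
    where
    nonZeroTuples : Enumeration (≋-setoid n) (suc (suc q′ ^ n ∸ 1))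
    nonZeroTuples = ≡.subst (Enumeration (≋-setoid n))
      (≡.sym (≡.trans (ℕ.+-comm 1 (suc q′ ^ n ∸ 1)) (m∸n+n≡m (m^n>0 (suc q′) n))))
      (pointwise (without scalars 0#) n)

corollary2 : ∀ {c ℓ} (F : CommutativeRing c ℓ) → IsField F →
    (q : ℕ) → HasCardinality F q →
    (n : ℕ) → 1 ≤ n →
    let open AffineGeometry F n in
    (B : Fin (suc n) → Point) → IsBasis B →
    Σ (Fin ((q ∸ 1) ^ n ∸ 1) → Hyperplane) (λ Hs →
      (∀ k → Avoids B (Hs k)) ×
      (∀ k l → SameHyperplane (Hs k) (Hs l) → k ≡ l) ×
      (∀ H → Avoids B H → Σ (Fin ((q ∸ 1) ^ n ∸ 1)) (λ k → SameHyperplane H (Hs k))))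
corollary2 F isField q card n _ B basis =
  hyperplaneOf ∘ enum ,
  hyperplaneOf-avoids ∘ enum ,
  (λ k l same → enum-injective k l (hyperplaneOf-injective (enum k) (enum l) same)) ,
  (λ H avoids → let p = profileOf H avoids in
     index p , same-hyperplaneOf-profileOf H avoids (enum (index p)) (enum-index p))
  where
  open FieldLemmas F isField using (cardinality≥2)
  open AvoidingHyperplanes F isField card n B basis
  open Enumeration (profiles (cardinality≥2 card))
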